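{- Let $X$ be a finite digraph (no loops, no parallel arcs). The $A$-Laplacian $L(X)$ of $X$ is normal (i.e. $L(X)L(X)^T = L(X)^T L(X)$) if and only if, for every pair of vertices $u,v$, \[ d^-(u,v) - d^+(u,v) = \begin{cases} 0 & \text{if } uv, vu \in E(X) \text{ or } uv, vu \notin E(X); \\ d(u)-d(v) & \text{if } uv\in E(X) \text{ and } vu \notin E(X);\\ d(v)-d(u) & \text{if } vu\in E(X) \text{ and } uv \notin E(X). \end{cases} \]
   Context: For a digraph $X$ with vertex set $V(X)$ and arc set $E(X)$, $A(X)$ is the adjacency matrix ($A(u,v)=1$ if $uv$ is an arc, else $0$), $\Delta^+(X)$ is the diagonal matrix whose $(u,u)$ entry is the out-degree $d(u)$ of $u$, and the $A$-Laplacian is $L(X)=\Delta^+(X)-A(X)$. For vertices $u,v$: $d^+(u,v) = |\{w : uw, vw \in E(X)\}|$ (number of common out-neighbours) and $d^-(u,v) = |\{w : wu, wv \in E(X)\}|$ (number of common in-neighbours). Here $d(u)$ denotes the out-degree of $u$. -}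

module Defs where

open import Data.Nat using (ℕ; zero; suc)
open import Data.Fin using (Fin; zero; suc)
open import Data.Bool using (Bool; true; false; _∧_)
open import Data.Integer using (ℤ; _+_; _-_; _*_; +_; 0ℤ; 1ℤ)
open import Relation.Binary.PropositionalEquality using (_≡_)
open import Relation.Nullary using (does)
open import Data.Fin using (_≟_)

-- A finite digraph on vertex set Fin n: arcs given by a Boolean relation.
-- Using a relation (not a multiset of arcs) rules out parallel arcs;
-- looplessness is a field.
record Digraph (n : ℕ) : Set where
  field
    arc     : Fin n → Fin n → Bool
    loopless : ∀ u → arc u u ≡ false
open Digraph public

∑ : ∀ {n} → (Fin n → ℤ) → ℤ
∑ {zero}  f = 0ℤ
∑ {suc n} f = f zero + ∑ (λ i → f (suc i))

count : ∀ {n} → (Fin n → Bool) → ℤ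
count f = ∑ (λ i → b2z (f i))
  where
    b2z : Bool → ℤ
    b2z true  = 1ℤ
    b2z false = 0ℤ

Matrix : ℕ → Set
Matrix n = Fin n → Fin n → ℤ

_ᵀ : ∀ {n} → Matrix n → Matrix n
(M ᵀ) i j = M j i

_⊗_ : ∀ {n} → Matrix n → Matrix n → Matrix n
(M ⊗ N) i j = ∑ (λ k → M i k * N k j)

bool→ℤ : Bool → ℤ
bool→ℤ true  = 1ℤ
bool→ℤ false = 0ℤ

module _ {n : ℕ} (X : Digraph n) where
  adjacency : Matrix n
  adjacency u v = bool→ℤ (arc X u v)

  outdeg : Fin n → ℤ
  outdeg u = count (λ w → arc X u w)

  outdegDiag : Matrix n
  outdegDiag u v = if does (u ≟ v) then outdeg u else 0ℤ
    where open import Data.Bool using (if_then_else_)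

  laplacian : Matrix n
  laplacian u v = outdegDiag u v - adjacency u v

  dOut : Fin n → Fin n → ℤ
  dOut u v = count (λ w → arc X u w ∧ arc X v w)

  dIn : Fin n → Fin n → ℤ
  dIn u v = count (λ w → arc X w u ∧ arc X w v)

  IsNormal : Matrix n → Set
  IsNormal L = ∀ i j → (L ⊗ (L ᵀ)) i j ≡ ((L ᵀ) ⊗ L) i j

  rhs : Fin n → Fin n → ℤ
  rhs u v with arc X u v | arc X v u
  ... | true  | true  = 0ℤ
  ... | false | false = 0ℤ
  ... | true  | false = outdeg u - outdeg v
  ... | false | true  = outdeg v - outdeg u

module Submission where

-- Write L = D - A with D = Δ⁺(X) diagonal and A = A(X).
-- Since D is diagonal (so Dᵀ = D), expanding both products gives, entrywise,
--   (L Lᵀ)(u,v) = (D D)(u,v) - A(u,v) d(v) - d(u) A(v,u) + d⁺(u,v),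
--   (Lᵀ L)(u,v) = (D D)(u,v) - A(v,u) d(v) - d(u) A(u,v) + d⁻(u,v),
-- using (A Aᵀ)(u,v) = d⁺(u,v) and (Aᵀ A)(u,v) = d⁻(u,v).  Subtracting,
--   (Lᵀ L - L Lᵀ)(u,v) = d⁻(u,v) - d⁺(u,v) - (d(u) - d(v))(A(u,v) - A(v,u)),
-- and the case distinction of the theorem is exactly (d(u) - d(v))(A(u,v) - A(v,u)).
-- Hence L is normal at (u,v) iff d⁻(u,v) - d⁺(u,v) equals that case expression.

open import Defs
open import Data.Nat using (ℕ; zero; suc)
open import Data.Fin using (Fin; zero; suc; _≟_)
open import Data.Bool using (Bool; true; false; _∧_; if_then_else_)
open import Data.Integer using (ℤ; _+_; _-_; _*_; 0ℤ; 1ℤ)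
open import Data.Integer.Properties using (i-j≡0⇒i≡j; i≡j⇒i-j≡0; +-identityˡ; +-identityʳ; *-zeroʳ)
open import Data.Integer.Tactic.RingSolver using (solve-∀)
open import Relation.Binary.PropositionalEquality
  using (_≡_; _≢_; refl; sym; trans; cong; cong₂; ≢-sym; module ≡-Reasoning)
open import Relation.Nullary using (does; yes; no; contradiction)
open import Function.Bundles using (_⇔_; mk⇔; module Equivalence)

∑-cong : ∀ {n} {f g : Fin n → ℤ} → (∀ k → f k ≡ g k) → ∑ f ≡ ∑ g
∑-cong {zero}  eq = refl
∑-cong {suc n} eq = cong₂ _+_ (eq zero) (∑-cong (λ k → eq (suc k)))

∑-distrib-- : ∀ {n} (f g : Fin n → ℤ) → ∑ (λ k → f k - g k) ≡ ∑ f - ∑ g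
∑-distrib-- {zero}  f g = refl
∑-distrib-- {suc n} f g = begin
    f zero - g zero + ∑ (λ k → f (suc k) - g (suc k))
  ≡⟨ cong (f zero - g zero +_) (∑-distrib-- (λ k → f (suc k)) (λ k → g (suc k))) ⟩
    f zero - g zero + (∑ (λ k → f (suc k)) - ∑ (λ k → g (suc k)))
  ≡⟨ regroup (f zero) (g zero) (∑ (λ k → f (suc k))) (∑ (λ k → g (suc k))) ⟩
    f zero + ∑ (λ k → f (suc k)) - (g zero + ∑ (λ k → g (suc k)))
  ∎
  where
  open ≡-Reasoning
  regroup : ∀ (a b c e : ℤ) → a - b + (c - e) ≡ a + c - (b + e)
  regroup = solve-∀

∑-single : ∀ {n} (i : Fin n) (f : Fin n → ℤ) → (∀ k → k ≢ i → f k ≡ 0ℤ) → ∑ f ≡ f i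
∑-single {suc n} zero f vanish = begin
    f zero + ∑ (λ k → f (suc k))
  ≡⟨ cong (f zero +_) (trans (∑-cong (λ k → vanish (suc k) λ ())) (∑-zero {n})) ⟩
    f zero + 0ℤ
  ≡⟨ +-identityʳ (f zero) ⟩
    f zero
  ∎
  where
  open ≡-Reasoning
  ∑-zero : ∀ {m} → ∑ {m} (λ _ → 0ℤ) ≡ 0ℤ
  ∑-zero {zero}  = refl
  ∑-zero {suc m} = trans (+-identityˡ _) (∑-zero {m})
∑-single {suc n} (suc i) f vanish =
  trans (cong₂ _+_ (vanish zero λ ())
                   (∑-single i (λ k → f (suc k)) (λ k k≢i → vanish (suc k) (λ { refl → k≢i refl }))))
        (+-identityˡ (f (suc i)))

count-as-∑ : ∀ {n} (p : Fin n → Bool) → count p ≡ ∑ (λ k → bool→ℤ (p k))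
count-as-∑ {zero}  p = refl
count-as-∑ {suc n} p with p zero
... | true  = cong (1ℤ +_) (count-as-∑ (λ k → p (suc k)))
... | false = cong (0ℤ +_) (count-as-∑ (λ k → p (suc k)))

bool→ℤ-∧ : ∀ a b → bool→ℤ (a ∧ b) ≡ bool→ℤ a * bool→ℤ b
bool→ℤ-∧ true  true  = refl
bool→ℤ-∧ true  false = refl
bool→ℤ-∧ false b     = refl

_⊖_ : ∀ {n} → Matrix n → Matrix n → Matrix n
(M ⊖ N) i j = M i j - N i j

infix 4 _≐_
_≐_ : ∀ {n} → Matrix n → Matrix n → Set
M ≐ N = ∀ i j → M i j ≡ N i j

diag : ∀ {n} → (Fin n → ℤ) → Matrix n
diag g i j = if does (i ≟ j) then g i else 0ℤ

diag-on : ∀ {n} (g : Fin n → ℤ) i → diag g i i ≡ g i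
diag-on g i with i ≟ i
... | yes _   = refl
... | no i≢i  = contradiction refl i≢i

diag-off : ∀ {n} (g : Fin n → ℤ) {i j} → i ≢ j → diag g i j ≡ 0ℤ
diag-off g {i} {j} i≢j with i ≟ j
... | yes i≡j = contradiction i≡j i≢j
... | no _    = refl

diag-sym : ∀ {n} (g : Fin n → ℤ) → diag g ᵀ ≐ diag g
diag-sym g i j with i ≟ j
... | yes refl = diag-on g i
... | no i≢j   = diag-off g (≢-sym i≢j)

diag-⊗ˡ : ∀ {n} (g : Fin n → ℤ) (M : Matrix n) i j → (diag g ⊗ M) i j ≡ g i * M i j
diag-⊗ˡ g M i j =
  trans (∑-single i _ (λ k k≢i → cong (_* M k j) (diag-off g (≢-sym k≢i))))
        (cong (_* M i j) (diag-on g i))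

diag-⊗ʳ : ∀ {n} (g : Fin n → ℤ) (M : Matrix n) i j → (M ⊗ diag g) i j ≡ M i j * g j
diag-⊗ʳ g M i j =
  trans (∑-single j _ (λ k k≢j → trans (cong (M i k *_) (diag-off g k≢j)) (*-zeroʳ (M i k))))
        (cong (M i j *_) (diag-on g j))

⊗-congˡ : ∀ {n} {M M′ : Matrix n} (N : Matrix n) → M ≐ M′ → (M ⊗ N) ≐ (M′ ⊗ N)
⊗-congˡ N eq i j = ∑-cong (λ k → cong (_* N k j) (eq i k))

⊗-congʳ : ∀ {n} (M : Matrix n) {N N′ : Matrix n} → N ≐ N′ → (M ⊗ N) ≐ (M ⊗ N′)
⊗-congʳ M eq i j = ∑-cong (λ k → cong (M i k *_) (eq k j))

⊗-distribˡ-⊖ : ∀ {n} (M N P : Matrix n) → (M ⊗ (N ⊖ P)) ≐ ((M ⊗ N) ⊖ (M ⊗ P))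
⊗-distribˡ-⊖ M N P i j =
  trans (∑-cong (λ k → *-distrib (M i k) (N k j) (P k j)))
        (∑-distrib-- (λ k → M i k * N k j) (λ k → M i k * P k j))
  where
  *-distrib : ∀ (a b c : ℤ) → a * (b - c) ≡ a * b - a * c
  *-distrib = solve-∀

⊗-distribʳ-⊖ : ∀ {n} (M N P : Matrix n) → ((M ⊖ N) ⊗ P) ≐ ((M ⊗ P) ⊖ (N ⊗ P))
⊗-distribʳ-⊖ M N P i j =
  trans (∑-cong (λ k → *-distrib (M i k) (N i k) (P k j)))
        (∑-distrib-- (λ k → M i k * P k j) (λ k → N i k * P k j))
  where
  *-distrib : ∀ (a b c : ℤ) → (a - b) * c ≡ a * c - b * c
  *-distrib = solve-∀

-- Expansion of a product of two differences whose first terms are the same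
-- diagonal matrix, the shape taken by both L Lᵀ and Lᵀ L.
diag-difference-product : ∀ {n} (g : Fin n → ℤ) (M N : Matrix n) i j →
  ((diag g ⊖ M) ⊗ (diag g ⊖ N)) i j
    ≡ ((diag g ⊗ diag g) i j - M i j * g j) - (g i * N i j - (M ⊗ N) i j)
diag-difference-product g M N i j = begin
    ((diag g ⊖ M) ⊗ (diag g ⊖ N)) i j
  ≡⟨ ⊗-distribˡ-⊖ (diag g ⊖ M) (diag g) N i j ⟩
    ((diag g ⊖ M) ⊗ diag g) i j - ((diag g ⊖ M) ⊗ N) i j
  ≡⟨ cong₂ _-_ (⊗-distribʳ-⊖ (diag g) M (diag g) i j) (⊗-distribʳ-⊖ (diag g) M N i j) ⟩
    ((diag g ⊗ diag g) i j - (M ⊗ diag g) i j) - ((diag g ⊗ N) i j - (M ⊗ N) i j)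
  ≡⟨ cong₂ (λ a b → ((diag g ⊗ diag g) i j - a) - (b - (M ⊗ N) i j))
           (diag-⊗ʳ g M i j) (diag-⊗ˡ g N i j) ⟩
    ((diag g ⊗ diag g) i j - M i j * g j) - (g i * N i j - (M ⊗ N) i j)
  ∎
  where open ≡-Reasoning

module _ {n : ℕ} (X : Digraph n) where

  private
    A = adjacency X
    d = outdeg X
    D = diag d
    L = laplacian X

  laplacianᵀ : L ᵀ ≐ (D ⊖ (A ᵀ))
  laplacianᵀ i j = cong (_- A j i) (diag-sym d i j)

  dOut-as-product : ∀ u v → dOut X u v ≡ (A ⊗ (A ᵀ)) u v
  dOut-as-product u v =
    trans (count-as-∑ (λ k → arc X u k ∧ arc X v k))
          (∑-cong (λ k → bool→ℤ-∧ (arc X u k) (arc X v k)))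

  dIn-as-product : ∀ u v → dIn X u v ≡ ((A ᵀ) ⊗ A) u v
  dIn-as-product u v =
    trans (count-as-∑ (λ k → arc X k u ∧ arc X k v))
          (∑-cong (λ k → bool→ℤ-∧ (arc X k u) (arc X k v)))

  rhs-as-product : ∀ u v → rhs X u v ≡ (d u - d v) * (A u v - A v u)
  rhs-as-product u v with arc X u v | arc X v u
  ... | true  | true  = times-zero (d u) (d v)
    where
    times-zero : ∀ (a b : ℤ) → 0ℤ ≡ (a - b) * (1ℤ - 1ℤ)
    times-zero = solve-∀
  ... | false | false = times-zero (d u) (d v)
    where
    times-zero : ∀ (a b : ℤ) → 0ℤ ≡ (a - b) * (0ℤ - 0ℤ)
    times-zero = solve-∀
  ... | true  | false = times-one (d u) (d v)
    where
    times-one : ∀ (a b : ℤ) → a - b ≡ (a - b) * (1ℤ - 0ℤ)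
    times-one = solve-∀
  ... | false | true  = times-minus-one (d u) (d v)
    where
    times-minus-one : ∀ (a b : ℤ) → b - a ≡ (a - b) * (0ℤ - 1ℤ)
    times-minus-one = solve-∀

  laplacian-Lᵀ-entry : ∀ u v →
    (L ⊗ (L ᵀ)) u v ≡ ((D ⊗ D) u v - A u v * d v) - (d u * A v u - dOut X u v)
  laplacian-Lᵀ-entry u v = begin
      (L ⊗ (L ᵀ)) u v
    ≡⟨ ⊗-congʳ L laplacianᵀ u v ⟩
      ((D ⊖ A) ⊗ (D ⊖ (A ᵀ))) u v
    ≡⟨ diag-difference-product d A (A ᵀ) u v ⟩
      ((D ⊗ D) u v - A u v * d v) - (d u * A v u - (A ⊗ (A ᵀ)) u v)
    ≡⟨ cong (λ z → ((D ⊗ D) u v - A u v * d v) - (d u * A v u - z)) (sym (dOut-as-product u v)) ⟩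
      ((D ⊗ D) u v - A u v * d v) - (d u * A v u - dOut X u v)
    ∎
    where open ≡-Reasoning

  Lᵀ-laplacian-entry : ∀ u v →
    ((L ᵀ) ⊗ L) u v ≡ ((D ⊗ D) u v - A v u * d v) - (d u * A u v - dIn X u v)
  Lᵀ-laplacian-entry u v = begin
      ((L ᵀ) ⊗ L) u v
    ≡⟨ ⊗-congˡ L laplacianᵀ u v ⟩
      ((D ⊖ (A ᵀ)) ⊗ (D ⊖ A)) u v
    ≡⟨ diag-difference-product d (A ᵀ) A u v ⟩
      ((D ⊗ D) u v - A v u * d v) - (d u * A u v - ((A ᵀ) ⊗ A) u v)
    ≡⟨ cong (λ z → ((D ⊗ D) u v - A v u * d v) - (d u * A u v - z)) (sym (dIn-as-product u v)) ⟩
      ((D ⊗ D) u v - A v u * d v) - (d u * A u v - dIn X u v)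
    ∎
    where open ≡-Reasoning

  commutator-entry : ∀ u v →
    ((L ᵀ) ⊗ L) u v - (L ⊗ (L ᵀ)) u v ≡ (dIn X u v - dOut X u v) - rhs X u v
  commutator-entry u v = begin
      ((L ᵀ) ⊗ L) u v - (L ⊗ (L ᵀ)) u v
    ≡⟨ cong₂ _-_ (Lᵀ-laplacian-entry u v) (laplacian-Lᵀ-entry u v) ⟩
      (((D ⊗ D) u v - A v u * d v) - (d u * A u v - dIn X u v))
        - (((D ⊗ D) u v - A u v * d v) - (d u * A v u - dOut X u v))
    ≡⟨ cancel ((D ⊗ D) u v) (d u) (d v) (A u v) (A v u) (dIn X u v) (dOut X u v) ⟩
      (dIn X u v - dOut X u v) - (d u - d v) * (A u v - A v u)
    ≡⟨ cong (dIn X u v - dOut X u v -_) (sym (rhs-as-product u v)) ⟩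
      (dIn X u v - dOut X u v) - rhs X u v
    ∎
    where
    open ≡-Reasoning
    cancel : ∀ (s du dv a a′ i o : ℤ) →
      ((s - a′ * dv) - (du * a - i)) - ((s - a * dv) - (du * a′ - o))
        ≡ (i - o) - (du - dv) * (a - a′)
    cancel = solve-∀

≡⇔≡-by-differences : ∀ {a b c e : ℤ} → b - a ≡ c - e → (a ≡ b) ⇔ (c ≡ e)
≡⇔≡-by-differences {a} {b} {c} {e} diff = mk⇔
  (λ a≡b → i-j≡0⇒i≡j c e (trans (sym diff) (i≡j⇒i-j≡0 (sym a≡b))))
  (λ c≡e → sym (i-j≡0⇒i≡j b a (trans diff (i≡j⇒i-j≡0 c≡e))))

lemma2p1 : ∀ {n : ℕ} (X : Digraph n) →
    IsNormal X (laplacian X) ⇔ (∀ (u v : Fin n) → dIn X u v - dOut X u v ≡ rhs X u v)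
lemma2p1 X = mk⇔
  (λ normal u v → Equivalence.to (entrywise u v) (normal u v))
  (λ degrees u v → Equivalence.from (entrywise u v) (degrees u v))
  where
  entrywise : ∀ u v →
    ((laplacian X ⊗ (laplacian X ᵀ)) u v ≡ ((laplacian X ᵀ) ⊗ laplacian X) u v)
      ⇔ (dIn X u v - dOut X u v ≡ rhs X u v)
  entrywise u v = ≡⇔≡-by-differences (commutator-entry X u v)
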